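{- Let $H$ be a connected interval $d$-uniform hypergraph ($d\ge2$). Then $\mathrm{Z}_{pd}(H)=1$.
   Context: An interval $d$-hypergraph here has vertex set $[n]$ and every edge is of the form $\{\ell,\ell+1,\dots,\ell+d-1\}$ for some $\ell\in\{1,\dots,n-d+1\}$. A path is an alternating sequence $v_1,e_1,v_2,\dots,e_s,v_{s+1}$ of distinct vertices and distinct edges with $v_i,v_{i+1}\in e_i$; $H$ is connected if any two vertices are joined by a path. A vertex $w$ is a neighbor of $v$ if some edge contains both. Power domination zero forcing: initially the vertices of a set $B$ are blue and the rest white. Power domination color change rule: if all the white neighbors of a blue vertex $v$ lie in one edge that contains $v$, then all these white neighbors become blue. $\mathrm{Z}_{pd}(H)$ is the minimum cardinality of a set $B$ from which repeated application of this rule colors every vertex blue. -}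

module Defs where

open import Data.Nat using (ℕ; suc; _+_; _≤_; _<_)
open import Data.Bool using (Bool; true)
open import Data.Fin using (Fin; toℕ)
open import Data.Fin.Subset using (Subset; _∈_; _∉_; ∣_∣)
open import Data.List using (List; []; _∷_)
open import Data.List.Relation.Unary.Unique.Propositional using (Unique)
open import Data.Product using (Σ; ∃; ∃-syntax; _×_)
open import Data.Sum using (_⊎_)
open import Relation.Binary.PropositionalEquality using (_≡_)
open import Relation.Binary.Construct.Closure.ReflexiveTransitive using (Star)

-- Vertex i : Fin n stands for the integer toℕ i + 1.
-- An edge is determined by its starting point ℓ and equals {ℓ,…,ℓ+d-1};
-- the edge set is given by the (Boolean) predicate isEdge on starting points,
-- and every edge must satisfy 1 ≤ ℓ ≤ n-d+1 (i.e. ℓ + d ≤ n + 1).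
record IntervalHypergraph (n d : ℕ) : Set where
  field
    isEdge     : ℕ → Bool
    edge-range : ∀ ℓ → isEdge ℓ ≡ true → (1 ≤ ℓ) × (ℓ + d ≤ suc n)
open IntervalHypergraph public

module _ {n d : ℕ} (H : IntervalHypergraph n d) where

  _∈ₑ_ : Fin n → ℕ → Set
  v ∈ₑ ℓ = (ℓ ≤ suc (toℕ v)) × (suc (toℕ v) < ℓ + d)

  IsEdge : ℕ → Set
  IsEdge ℓ = isEdge H ℓ ≡ true

  Neighbor : Fin n → Fin n → Set
  Neighbor v w = ∃[ ℓ ] (IsEdge ℓ × v ∈ₑ ℓ × w ∈ₑ ℓ)

  data Chain : Fin n → List (Fin n) → List ℕ → Fin n → Set where
    single : ∀ v → Chain v (v ∷ []) [] v
    step   : ∀ {v v′ w vs es} ℓ → IsEdge ℓ → v ∈ₑ ℓ → v′ ∈ₑ ℓ →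
             Chain v′ vs es w → Chain v (v ∷ vs) (ℓ ∷ es) w

  Path : Fin n → Fin n → Set
  Path u w = ∃[ vs ] ∃[ es ] (Chain u vs es w × Unique vs × Unique es)

  Connected : Set
  Connected = ∀ u w → Path u w

  PdStep : Subset n → Subset n → Set
  PdStep S S′ =
    ∃[ v ] (v ∈ S ×
      (∃[ ℓ ] (IsEdge ℓ × v ∈ₑ ℓ × (∀ w → Neighbor v w → w ∉ S → w ∈ₑ ℓ))) ×
      (∀ w → (w ∈ S′ → (w ∈ S ⊎ Neighbor v w)) × ((w ∈ S ⊎ Neighbor v w) → w ∈ S′)))

  PdForcing : Subset n → Set
  PdForcing B = ∃[ S ] (Star PdStep B S × (∀ w → w ∈ S))

  Zpd≡ : ℕ → Set
  Zpd≡ k = (∃[ B ] (∣ B ∣ ≡ k × PdForcing B)) × (∀ B → PdForcing B → k ≤ ∣ B ∣)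

-- Colour only vertex 1. If {1,…,m} is blue with m < n, connectivity gives an edge containing
-- both m and m + 1; among the edges starting at or before m take the last one, say {ℓ,…,ℓ+d-1}.
-- Every neighbour of m lies in an edge starting at or before m, hence at or before ℓ + d - 1,
-- so all white neighbours of m lie in that edge and m forces the prefix up to ℓ + d - 1 > m.
-- Conversely no empty set forces anything: every colour change needs a blue vertex.
module Submission where

open import Defs
open import Data.Nat using (ℕ; zero; suc; _+_; _∸_; _≤_; _<_; z≤n; s≤s; _<?_)
open import Data.Nat.Properties
  using (≤-refl; ≤-trans; ≤-reflexive; <-≤-trans; ≤-<-trans; <-trans; <⇒≤; ≤-pred; n<1+n;
         m≤n⇒m≤1+n; m≤n⇒m<n∨m≡n; ≮⇒≥; +-monoˡ-≤; ∸-monoʳ-<; <-irrefl)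
open import Data.Nat.Induction using (<-wellFounded)
open import Induction.WellFounded using (Acc; acc)
open import Data.Bool using (Bool; true; false)
open import Data.Fin using (Fin; toℕ; fromℕ<) renaming (zero to fzero; suc to fsuc)
open import Data.Fin.Properties using (toℕ<n; toℕ-fromℕ<)
open import Data.Fin.Subset using (Subset; _∈_; _∉_; ∣_∣; inside; outside; Nonempty)
open import Data.Fin.Subset.Properties using (∣⁅x⁆∣≡1; x∈⁅y⁆⇒x≡y; p⊆q⇒∣p∣≤∣q∣)
open import Data.Vec using ([]; _∷_; here; there)
open import Data.Product using (∃-syntax; _×_; _,_; proj₂)
open import Data.Sum using (_⊎_; inj₁; inj₂)
open import Function using (_∘_)
open import Relation.Nullary using (yes; no; contradiction)
open import Relation.Binary.PropositionalEquality using (_≡_; refl; sym; trans; cong; subst)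
open import Relation.Binary.Construct.Closure.ReflexiveTransitive using (ε; _◅_)

Nonempty⇒1≤∣p∣ : ∀ {n} {p : Subset n} → Nonempty p → 1 ≤ ∣ p ∣
Nonempty⇒1≤∣p∣ {p = p} (x , x∈p) =
  subst (_≤ ∣ p ∣) (∣⁅x⁆∣≡1 x) (p⊆q⇒∣p∣≤∣q∣ λ y∈⁅x⁆ → subst (_∈ p) (sym (x∈⁅y⁆⇒x≡y x y∈⁅x⁆)) x∈p)

-- The blue prefix {1,…,m}: vertex i has label toℕ i + 1, and edge starts ℓ are labels too.
first : (n m : ℕ) → Subset n
first zero    _       = []
first (suc n) zero    = outside ∷ first n zero
first (suc n) (suc m) = inside ∷ first n m

∈-first⁺ : ∀ {n} m (i : Fin n) → toℕ i < m → i ∈ first n m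
∈-first⁺ (suc m) fzero    _         = here
∈-first⁺ (suc m) (fsuc i) (s≤s i<m) = there (∈-first⁺ m i i<m)

∈-first⁻ : ∀ {n} m (i : Fin n) → i ∈ first n m → toℕ i < m
∈-first⁻ zero    fzero    ()
∈-first⁻ zero    (fsuc i) (there i∈) with () ← ∈-first⁻ zero i i∈
∈-first⁻ (suc m) fzero    _          = s≤s z≤n
∈-first⁻ (suc m) (fsuc i) (there i∈) = s≤s (∈-first⁻ m i i∈)

∣first∣ : ∀ {n m} → m ≤ n → ∣ first n m ∣ ≡ m
∣first∣ {zero}  z≤n       = refl
∣first∣ {suc n} z≤n       = ∣first∣ {n} z≤n
∣first∣ {suc n} (s≤s m≤n) = cong suc (∣first∣ m≤n)

greatest-true-≤ : (f : ℕ → Bool) {k m : ℕ} → f k ≡ true → k ≤ m →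
  ∃[ ℓ ] (f ℓ ≡ true × k ≤ ℓ × ℓ ≤ m × (∀ j → f j ≡ true → j ≤ m → j ≤ ℓ))
greatest-true-≤ f {m = m} fk k≤m with f m in fm | m≤n⇒m<n∨m≡n k≤m
... | true  | _        = m , fm , k≤m , ≤-refl , λ _ _ j≤m → j≤m
... | false | inj₂ refl = contradiction (trans (sym fk) fm) λ ()
... | false | inj₁ (s≤s k≤m′) with greatest-true-≤ f fk k≤m′
...   | ℓ , fℓ , k≤ℓ , ℓ≤m′ , greatest = ℓ , fℓ , k≤ℓ , m≤n⇒m≤1+n ℓ≤m′ , below
  where
  below : ∀ j → f j ≡ true → j ≤ m → j ≤ ℓ
  below j fj j≤m with m≤n⇒m<n∨m≡n j≤m
  ... | inj₁ (s≤s j≤m′) = greatest j fj j≤m′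
  ... | inj₂ refl       = contradiction (trans (sym fj) fm) λ ()

module _ {n d : ℕ} (H : IntervalHypergraph n d) where

  crossing-edge : ∀ m {u vs es w} → Chain H u vs es w → toℕ u < m → m ≤ toℕ w →
                  ∃[ ℓ ] (IsEdge H ℓ × ℓ ≤ m × suc m < ℓ + d)
  crossing-edge m (single _) u<m m≤w = contradiction (<-≤-trans u<m m≤w) (<-irrefl refl)
  crossing-edge m (step {v′ = v′} ℓ isEdge (ℓ≤u , _) (_ , v′<end) chain) u<m m≤w
    with toℕ v′ <? m
  ... | yes v′<m = crossing-edge m chain v′<m m≤w
  ... | no  v′≮m = ℓ , isEdge , ≤-trans ℓ≤u u<m , ≤-<-trans (s≤s (≮⇒≥ v′≮m)) v′<end

  LastEdgeUpTo : ℕ → ℕ → Set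
  LastEdgeUpTo m ℓ = IsEdge H ℓ × ℓ ≤ m × (∀ k → IsEdge H k → k ≤ m → k ≤ ℓ)

  neighbor-<-end : ∀ {v x ℓ} → LastEdgeUpTo (suc (toℕ v)) ℓ → Neighbor H v x → suc (toℕ x) < ℓ + d
  neighbor-<-end (_ , _ , last) (k , isEdge , (k≤v , _) , (_ , x<end)) =
    <-≤-trans x<end (+-monoˡ-≤ d (last k isEdge k≤v))

  -- The edge start is written suc ℓ′ so that its last label ℓ + d - 1 is simply ℓ′ + d.
  PdStep-first : (v : Fin n) {ℓ′ : ℕ} → LastEdgeUpTo (suc (toℕ v)) (suc ℓ′) →
                 suc (toℕ v) < ℓ′ + d → PdStep H (first n (suc (toℕ v))) (first n (ℓ′ + d))
  PdStep-first v {ℓ′} last@(isEdge , ℓ≤v , _) v<end =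
    v , ∈-first⁺ _ v (n<1+n _) , (suc ℓ′ , isEdge , v∈ℓ , white∈ℓ) , λ x → grow x , shrink x
    where
    m = suc (toℕ v)

    v∈ℓ : _∈ₑ_ H v (suc ℓ′)
    v∈ℓ = ℓ≤v , s≤s (<⇒≤ v<end)

    outside-first-∈ₑ : ∀ x → x ∉ first n m → toℕ x < ℓ′ + d → _∈ₑ_ H x (suc ℓ′)
    outside-first-∈ₑ x x∉ x<end = ≤-trans ℓ≤v (m≤n⇒m≤1+n (≮⇒≥ (x∉ ∘ ∈-first⁺ m x))) , s≤s x<end

    white∈ℓ : ∀ x → Neighbor H v x → x ∉ first n m → _∈ₑ_ H x (suc ℓ′)
    white∈ℓ x nb x∉ = outside-first-∈ₑ x x∉ (≤-pred (neighbor-<-end last nb))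

    grow : ∀ x → x ∈ first n (ℓ′ + d) → x ∈ first n m ⊎ Neighbor H v x
    grow x x∈ with toℕ x <? m
    ... | yes x<m = inj₁ (∈-first⁺ m x x<m)
    ... | no  x≮m = inj₂ (suc ℓ′ , isEdge , v∈ℓ ,
                          outside-first-∈ₑ x (λ x∈m → x≮m (∈-first⁻ m x x∈m)) (∈-first⁻ _ x x∈))

    shrink : ∀ x → x ∈ first n m ⊎ Neighbor H v x → x ∈ first n (ℓ′ + d)
    shrink x (inj₁ x∈) = ∈-first⁺ _ x (<-trans (∈-first⁻ m x x∈) v<end)
    shrink x (inj₂ nb) = ∈-first⁺ _ x (≤-pred (neighbor-<-end last nb))

  module _ (connected : Connected H) where

    last-edge-over : (v : Fin n) → suc (toℕ v) < n →
      ∃[ ℓ′ ] (LastEdgeUpTo (suc (toℕ v)) (suc ℓ′) × suc (toℕ v) < ℓ′ + d)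
    last-edge-over v v<n with connected v (fromℕ< v<n)
    ... | _ , _ , chain , _
      with crossing-edge (suc (toℕ v)) chain (n<1+n _) (≤-reflexive (sym (toℕ-fromℕ< v<n)))
    ... | ℓ₀ , isEdge₀ , ℓ₀≤v , v<end₀
      with greatest-true-≤ (isEdge H) isEdge₀ ℓ₀≤v
    ... | ℓ , isEdge , ℓ₀≤ℓ , ℓ≤v , last with edge-range H ℓ isEdge
    ... | s≤s {n = ℓ′} z≤n , _ =
      ℓ′ , (isEdge , ℓ≤v , last) , ≤-pred (<-≤-trans v<end₀ (+-monoˡ-≤ d ℓ₀≤ℓ))

    PdStep-first-connected : ∀ {m} → 1 ≤ m → m < n →
      ∃[ m′ ] (m < m′ × m′ ≤ n × PdStep H (first n m) (first n m′))
    PdStep-first-connected {suc m₀} _ m<n with fromℕ< (<⇒≤ m<n) | toℕ-fromℕ< (<⇒≤ m<n)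
    ... | v | refl with last-edge-over v m<n
    ...   | ℓ′ , last@(isEdge , _) , v<end =
      ℓ′ + d , v<end , ≤-pred (proj₂ (edge-range H (suc ℓ′) isEdge)) , PdStep-first v last v<end

    first-PdForcing : ∀ m → 1 ≤ m → Acc _<_ (n ∸ m) → PdForcing H (first n m)
    first-PdForcing m 1≤m (acc smaller) with m <? n
    ... | no m≮n = first n m , ε , λ w → ∈-first⁺ m w (<-≤-trans (toℕ<n w) (≮⇒≥ m≮n))
    ... | yes m<n with PdStep-first-connected 1≤m m<n
    ...   | m′ , m<m′ , m′≤n , pdStep
      with first-PdForcing m′ (≤-trans 1≤m (<⇒≤ m<m′)) (smaller (∸-monoʳ-< m<m′ m′≤n))
    ...   | S , steps , all-blue = S , pdStep ◅ steps , all-blue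

  PdForcing-nonempty : ∀ {B} → Fin n → PdForcing H B → Nonempty B
  PdForcing-nonempty x (_ , ε , all-blue)          = x , all-blue x
  PdForcing-nonempty _ (_ , (v , v∈B , _) ◅ _ , _) = v , v∈B

proposition3p11 : ∀ (n d : ℕ) (H : IntervalHypergraph n d) →
    2 ≤ d → 1 ≤ n → Connected H → Zpd≡ H 1
proposition3p11 (suc n) d H _ _ connected =
  (first (suc n) 1 , ∣first∣ {suc n} (s≤s z≤n) ,
   first-PdForcing H connected 1 (s≤s z≤n) (<-wellFounded _)) ,
  λ B forcing → Nonempty⇒1≤∣p∣ (PdForcing-nonempty H fzero forcing)
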